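{- If $G$ is a graph with no universal vertex, then $$\mathrm{vv}(G)\le\left\lfloor\frac{n(G)\Delta(G)-1}{\Delta(G)+1}\right\rfloor,$$ and the bound is sharp (equality holds, e.g., for the cocktail party graph $K_{k\times 2}$, $k\ge 2$).
   Context: All graphs are finite and simple; $n(G)$ is the order and $\Delta(G)$ the maximum degree of $G$. A universal vertex is adjacent to all other vertices. $K_{k\times 2}$ is the complete $k$-partite graph with all parts of size $2$. For $x\in V(G)$, a set $S\subseteq V(G)\setminus\{x\}$ is an $x$-visibility set if for every $y\in S$ there exists a shortest $x,y$-path $P$ with $V(P)\cap S=\{y\}$; $v_x(G)$ is the maximum size of an $x$-visibility set and $\mathrm{vv}(G)=\max_{x\in V(G)} v_x(G)$. -}

module Defs where

open import Data.Nat using (ℕ; zero; suc; _+_; _*_; _∸_; _⊔_; _≤_; _/_)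
open import Data.Fin using (Fin)
open import Data.Bool using (Bool; true; false; T)
open import Data.List using (List; []; _∷_; length; filter; map; foldr; allFin)
open import Data.List.Membership.Propositional using (_∈_; _∉_)
open import Data.List.Relation.Unary.Unique.Propositional using (Unique)
open import Data.Product using (Σ; ∃; _×_; _,_)
open import Relation.Binary.PropositionalEquality using (_≡_; _≢_)
open import Relation.Nullary using (¬_)
open import Relation.Nullary.Decidable using (does)
open import Relation.Unary using (Decidable)

record Graph (n : ℕ) : Set where
  field
    adj    : Fin n → Fin n → Bool
    adj-sym    : ∀ x y → adj x y ≡ adj y x
    adj-irrefl : ∀ x → adj x x ≡ false

open Graph public

Adj : ∀ {n} → Graph n → Fin n → Fin n → Set
Adj G x y = T (adj G x y)

order : ∀ {n} → Graph n → ℕ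
order {n} _ = n

deg : ∀ {n} → Graph n → Fin n → ℕ
deg {n} G v = length (filter (λ u → T? (adj G v u)) (allFin n))
  where
    open import Relation.Nullary.Decidable using (Dec)
    T? : (b : Bool) → Dec (T b)
    T? = Data.Bool.T?

maxDeg : ∀ {n} → Graph n → ℕ
maxDeg {n} G = foldr _⊔_ 0 (map (deg G) (allFin n))

Universal : ∀ {n} → Graph n → Fin n → Set
Universal G x = ∀ y → y ≢ x → Adj G x y

data Walk {n} (G : Graph n) : Fin n → Fin n → Set where
  stop : ∀ {x} → Walk G x x
  step : ∀ {x y z} → Adj G x y → Walk G y z → Walk G x z

walkLength : ∀ {n} {G : Graph n} {x y} → Walk G x y → ℕ
walkLength stop       = 0
walkLength (step _ w) = suc (walkLength w)

walkVertices : ∀ {n} {G : Graph n} {x y} → Walk G x y → List (Fin n)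
walkVertices {x = x} stop       = x ∷ []
walkVertices {x = x} (step _ w) = x ∷ walkVertices w

IsShortest : ∀ {n} {G : Graph n} {x y} → Walk G x y → Set
IsShortest {G = G} {x} {y} p = ∀ (q : Walk G x y) → walkLength p ≤ walkLength q

IsVisibilitySet : ∀ {n} → Graph n → Fin n → List (Fin n) → Set
IsVisibilitySet G x S =
  Unique S × x ∉ S ×
  (∀ y → y ∈ S → Σ (Walk G x y) λ P →
     IsShortest P × (∀ v → v ∈ walkVertices P → v ∈ S → v ≡ y))

-- the cocktail party graph K_{k×2} on Fin (2k): vertices i and j are
-- non-adjacent iff they lie in the same part {2t, 2t+1}, i.e. ⌊i/2⌋ = ⌊j/2⌋
cocktail : (k : ℕ) → Graph (k * 2)
cocktail k = record { adj = a ; adj-sym = s ; adj-irrefl = r }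
  where
    open import Data.Fin using (toℕ)
    open import Data.Nat.Properties using (_≟_)
    open import Data.Bool using (not)
    open import Relation.Binary.PropositionalEquality using (refl) renaming (sym to ≡-sym)
    a : Fin (k * 2) → Fin (k * 2) → Bool
    differ : ∀ {m m' : ℕ} → Relation.Nullary.Dec (m ≡ m') → Bool
    differ (Relation.Nullary.yes _) = false
    differ (Relation.Nullary.no _)  = true
    a i j = differ (toℕ i / 2 ≟ toℕ j / 2)
    s : ∀ x y → a x y ≡ a y x
    s x y with toℕ x / 2 ≟ toℕ y / 2 | toℕ y / 2 ≟ toℕ x / 2
    ... | Relation.Nullary.yes _ | Relation.Nullary.yes _ = refl
    ... | Relation.Nullary.no _  | Relation.Nullary.no _  = refl
    ... | Relation.Nullary.yes e | Relation.Nullary.no ne = Data.Empty.⊥-elim (ne (≡-sym e))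
      where import Data.Empty
    ... | Relation.Nullary.no ne | Relation.Nullary.yes e = Data.Empty.⊥-elim (ne (≡-sym e))
      where import Data.Empty
    r : ∀ x → a x x ≡ false
    r x with toℕ x / 2 ≟ toℕ x / 2
    ... | Relation.Nullary.yes _ = refl
    ... | Relation.Nullary.no ne = Data.Empty.⊥-elim (ne refl)
      where import Data.Empty

-- the bound ⌊(n Δ − 1)/(Δ + 1)⌋ (ℕ, truncated subtraction)
vvBound : ∀ {n} → Graph n → ℕ
vvBound {n} G = (n * maxDeg G ∸ 1) / suc (maxDeg G)

-- For y ∈ S not adjacent to x, the penultimate vertex
-- of the path witnessing y lies outside S ∪ {x}, so the n − |S| − 1 vertices outside
-- S ∪ {x} dominate the non-neighbours of x in S, and there are at most (n − |S| − 1)Δ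
-- of those.  If x has a neighbour outside S, at most Δ − 1 neighbours of x lie in S,
-- whence |S| ≤ (Δ − 1) + (n − |S| − 1)Δ.  Otherwise the second vertex of every
-- witnessing path lies in S, so S consists of neighbours of x: |S| ≤ Δ, and a
-- non-neighbour of x gives |S| ≤ n − 2.  Both cases rearrange to |S|(Δ + 1) + 1 ≤ nΔ.
-- For sharpness, Δ ≤ n − 1 caps the bound at n − 2 in every graph, and in K_{k×2} the
-- n − 2 neighbours of a vertex form a visibility set.
module Submission where

open import Defs
open import Data.Nat using (ℕ; _≤_; _≥_; _<_; zero; suc; pred; _+_; _*_; _∸_; _/_; z≤n; s≤s)
open import Data.Nat.Properties
open import Data.Nat.DivMod using (m*n/n≡m; /-monoˡ-≤; m<n*o⇒m/o<n; m/n≡1+[m∸n]/n)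
open import Data.Nat.Tactic.RingSolver using (solve-∀)
open import Data.Fin using (Fin; toℕ) renaming (zero to fzero; suc to fsuc)
import Data.Fin.Properties as Fin
open import Data.Bool using (T; T?)
open import Data.Unit using (tt)
open import Data.Empty using (⊥-elim)
open import Data.List using (List; []; _∷_; length; filter; map; allFin)
open import Data.List.Properties
  using (length-tabulate; length-map; length-++; length-removeAt′; filter-notAll; foldr-forcesᵇ; foldr-preservesᵇ)
open import Data.List.Membership.Propositional using (_∈_; _∉_)
open import Data.List.Membership.Propositional.Properties using (∈-filter⁺; ∈-filter⁻; ∈-allFin)
open import Data.List.Relation.Binary.Subset.Propositional using (_⊆_)
open import Data.List.Relation.Unary.Any as Any using (here; there; _─_)
open import Data.List.Relation.Unary.All as All using (All; _∷_)
open import Data.List.Relation.Unary.All.Properties using (¬Any⇒All¬)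
import Data.List.Relation.Unary.All.Properties as All
open import Data.List.Relation.Unary.AllPairs using (_∷_)
open import Data.List.Relation.Unary.Unique.Propositional using (Unique)
import Data.List.Relation.Unary.Unique.Propositional.Properties as Unique
open import Data.Product using (Σ; _×_; _,_; ∃-syntax; proj₁; proj₂)
open import Relation.Nullary using (¬_; Dec; yes; no; ¬?)
open import Relation.Nullary.Decidable using (_×-dec_; _→-dec_; decidable-stable)
open import Function using (_∘_)
open import Level using (0ℓ)
open import Relation.Unary using (Pred; Decidable)
open import Relation.Unary.Properties using (∁?)
open import Relation.Binary.PropositionalEquality using (_≡_; _≢_; refl; sym; trans; cong; subst; module ≡-Reasoning)

module _ {A : Set} where

  ∈-─ : ∀ {x a : A} {ys} (p : x ∈ ys) → a ∈ ys → a ≢ x → a ∈ (ys ─ p)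
  ∈-─ (here refl) (here refl) a≢x = ⊥-elim (a≢x refl)
  ∈-─ (here refl) (there q)   _   = q
  ∈-─ (there p)   (here refl) _   = here refl
  ∈-─ (there p)   (there q)   a≢x = there (∈-─ p q a≢x)

  Unique-⊆⇒length≤ : ∀ {xs ys : List A} → Unique xs → xs ⊆ ys → length xs ≤ length ys
  Unique-⊆⇒length≤ {[]}     _            _  = z≤n
  Unique-⊆⇒length≤ {x ∷ xs} {ys} (x∉xs ∷ u) xs⊆ys =
    subst (suc (length xs) ≤_) (sym (length-removeAt′ ys (Any.index x∈ys)))
      (s≤s (Unique-⊆⇒length≤ u λ a∈xs →
        ∈-─ x∈ys (xs⊆ys (there a∈xs)) λ a≡x → All.lookup x∉xs a∈xs (sym a≡x)))
    where
    x∈ys : x ∈ ys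
    x∈ys = xs⊆ys (here refl)

  length≤length-filter+length-filter-∁ : ∀ {P : Pred A 0ℓ} (P? : Decidable P) xs →
    length xs ≤ length (filter P? xs) + length (filter (∁? P?) xs)
  length≤length-filter+length-filter-∁ P? []       = z≤n
  length≤length-filter+length-filter-∁ P? (x ∷ xs) with P? x
  ... | yes _ = s≤s (length≤length-filter+length-filter-∁ P? xs)
  ... | no  _ = subst (suc (length xs) ≤_) (sym (+-suc _ _))
                  (s≤s (length≤length-filter+length-filter-∁ P? xs))

≤[n*d∸1]/[1+d] : ∀ s d n → s * suc d + 1 ≤ n * d → s ≤ (n * d ∸ 1) / suc d
≤[n*d∸1]/[1+d] s d n h =
  subst (_≤ (n * d ∸ 1) / suc d) (m*n/n≡m s (suc d))
    (/-monoˡ-≤ (suc d) (m+n≤o⇒m≤o∸n (s * suc d) h))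

[n*d∸1]/[1+d]≤n∸2 : ∀ n d → d ≤ pred n → (n * d ∸ 1) / suc d ≤ n ∸ 2
[n*d∸1]/[1+d]≤n∸2 zero          d    _   = z≤n
[n*d∸1]/[1+d]≤n∸2 (suc zero)    zero _   = z≤n
[n*d∸1]/[1+d]≤n∸2 (suc (suc m)) d    d≤ = ≤-pred (m<n*o⇒m/o<n (begin-strict
  (d + suc m * d) ∸ 1     ≤⟨ ∸-monoˡ-≤ 1 (+-monoˡ-≤ (suc m * d) d≤) ⟩
  m + suc m * d           <⟨ n<1+n _ ⟩
  suc m + suc m * d       ≡⟨ *-suc (suc m) d ⟨
  suc m * suc d           ∎))
  where open ≤-Reasoning

s*[1+d]+1≡s*d+[1+s] : ∀ s d → s * suc d + 1 ≡ s * d + suc s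
s*[1+d]+1≡s*d+[1+s] = solve-∀

open-case-arith : ∀ {s s₁ s₂ t d n} → s ≤ s₁ + s₂ → s₁ < d → s₂ ≤ t * d → s + t < n →
             s * suc d + 1 ≤ n * d
open-case-arith {s} {s₁} {s₂} {t} {d} {n} s≤ s₁< s₂≤ s+t< = begin
  s * suc d + 1         ≡⟨ s*[1+d]+1≡s*d+[1+s] s d ⟩
  s * d + suc s         ≤⟨ +-monoʳ-≤ (s * d) (s≤s s≤) ⟩
  s * d + (suc s₁ + s₂) ≤⟨ +-monoʳ-≤ (s * d) (+-mono-≤ s₁< s₂≤) ⟩
  s * d + (d + t * d)   ≡⟨ regroup s d t ⟩
  suc (s + t) * d       ≤⟨ *-monoˡ-≤ d s+t< ⟩
  n * d                 ∎
  where
  open ≤-Reasoning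
  regroup : ∀ s d t → s * d + (d + t * d) ≡ suc (s + t) * d
  regroup = solve-∀

closed-case-arith : ∀ {s d n} → 0 < s → s ≤ d → 2 + s ≤ n → s * suc d + 1 ≤ n * d
closed-case-arith {s} {d} {n} 0<s s≤d 2+s≤n = begin
  s * suc d + 1       ≡⟨ s*[1+d]+1≡s*d+[1+s] s d ⟩
  s * d + suc s       ≤⟨ +-monoʳ-≤ (s * d) (+-mono-≤ (≤-trans 0<s s≤d) s≤d) ⟩
  s * d + (d + d)     ≡⟨ regroup s d ⟩
  (2 + s) * d         ≤⟨ *-monoˡ-≤ d 2+s≤n ⟩
  n * d               ∎
  where
  open ≤-Reasoning
  regroup : ∀ s d → s * d + (d + d) ≡ (2 + s) * d
  regroup = solve-∀

length-allFin : ∀ n → length (allFin n) ≡ n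
length-allFin n = length-tabulate (λ i → i)

module _ {n : ℕ} (G : Graph n) where

  open import Data.List.Membership.DecPropositional (Fin._≟_ {n}) using (_∈?_)

  adj? : ∀ u v → Dec (Adj G u v)
  adj? u v = T? (adj G u v)

  ¬Adj-refl : ∀ {v} → ¬ Adj G v v
  ¬Adj-refl {v} = subst T (adj-irrefl G v)

  deg≤maxDeg : ∀ v → deg G v ≤ maxDeg G
  deg≤maxDeg v = All.lookup (All.map⁻ degs≤) (∈-allFin v)
    where
    degs≤ : All (_≤ maxDeg G) (map (deg G) (allFin n))
    degs≤ = foldr-forcesᵇ (λ a b h → m⊔n≤o⇒m≤o a b h , m⊔n≤o⇒n≤o a b h) 0 _ ≤-refl

  maxDeg-lub : ∀ {b} → (∀ v → deg G v ≤ b) → maxDeg G ≤ b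
  maxDeg-lub {b} deg≤b = foldr-preservesᵇ {P = _≤ b} ⊔-lub {xs = map (deg G) (allFin n)} z≤n
    (All.map⁺ (All.tabulate λ {v} _ → deg≤b v))

  deg<order : ∀ v → deg G v < n
  deg<order v = subst (deg G v <_) (length-allFin n)
    (filter-notAll (adj? v) (allFin n) (Any.map (λ { refl → ¬Adj-refl }) (∈-allFin v)))

  vvBound≤order∸2 : vvBound G ≤ n ∸ 2
  vvBound≤order∸2 = [n*d∸1]/[1+d]≤n∸2 n (maxDeg G) (maxDeg-lub λ v → <⇒≤pred (deg<order v))

  length≤order : ∀ {xs} → Unique xs → length xs ≤ n
  length≤order {xs} uxs = subst (length xs ≤_) (length-allFin n)
    (Unique-⊆⇒length≤ {ys = allFin n} uxs λ {v} _ → ∈-allFin v)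

  length≤maxDeg : ∀ {u xs} → Unique xs → All (Adj G u) xs → length xs ≤ maxDeg G
  length≤maxDeg {u} uxs adjs = ≤-trans
    (Unique-⊆⇒length≤ uxs λ v∈xs → ∈-filter⁺ (adj? u) (∈-allFin _) (All.lookup adjs v∈xs))
    (deg≤maxDeg u)

  complement : List (Fin n) → List (Fin n)
  complement xs = filter (∁? (_∈? xs)) (allFin n)

  ∉⇒∈-complement : ∀ {v xs} → v ∉ xs → v ∈ complement xs
  ∉⇒∈-complement v∉xs = ∈-filter⁺ (∁? (_∈? _)) (∈-allFin _) v∉xs

  length+length-complement≤order : ∀ {xs} → Unique xs → length xs + length (complement xs) ≤ n
  length+length-complement≤order {xs} uxs = subst (_≤ n) (length-++ xs)
    (length≤order (Unique.++⁺ uxs (Unique.filter⁺ (∁? (_∈? xs)) (Unique.allFin⁺ n)) disjoint))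
    where
    disjoint : ∀ {v} → ¬ (v ∈ xs × v ∈ complement xs)
    disjoint (v∈xs , v∈cxs) = proj₂ (∈-filter⁻ (∁? (_∈? xs)) {xs = allFin n} v∈cxs) v∈xs

  length≤length*maxDeg : ∀ ts {ys} → Unique ys → (∀ {y} → y ∈ ys → ∃[ t ] t ∈ ts × Adj G t y) →
                         length ys ≤ length ts * maxDeg G
  length≤length*maxDeg []       {[]}    _ _         = z≤n
  length≤length*maxDeg []       {_ ∷ _} _ dominated with dominated (here refl)
  ... | _ , () , _
  length≤length*maxDeg (t ∷ ts) {ys} uys dominated = ≤-trans
    (length≤length-filter+length-filter-∁ (adj? t) ys)
    (+-mono-≤ (length≤maxDeg (Unique.filter⁺ (adj? t) uys) (All.all-filter (adj? t) ys))
              (length≤length*maxDeg ts (Unique.filter⁺ (∁? (adj? t)) uys) dominated-rest))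
    where
    dominated-rest : ∀ {y} → y ∈ filter (∁? (adj? t)) ys → ∃[ t′ ] t′ ∈ ts × Adj G t′ y
    dominated-rest y∈ with ∈-filter⁻ (∁? (adj? t)) {xs = ys} y∈
    ... | y∈ys , ¬adj with dominated y∈ys
    ... | _ , here refl , adj-ty = ⊥-elim (¬adj adj-ty)
    ... | t′ , there t′∈ts , adj-t′y = t′ , t′∈ts , adj-t′y

  penultimate : ∀ {x w y} (a : Adj G x w) (p : Walk G w y) →
                ∃[ u ] u ∈ walkVertices (step a p) × Adj G u y
  penultimate {x} a stop       = x , here refl , a
  penultimate     a (step b p) with penultimate b p
  ... | u , u∈p , adj-uy = u , there u∈p , adj-uy

  head∈walkVertices : ∀ {w y} (p : Walk G w y) → w ∈ walkVertices p
  head∈walkVertices stop       = here refl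
  head∈walkVertices (step _ _) = here refl

  ¬Universal⇒non-neighbour : ∀ {x} → ¬ Universal G x → ∃[ z ] z ≢ x × ¬ Adj G x z
  ¬Universal⇒non-neighbour {x} ¬univ
    with Fin.¬∀⟶∃¬ n (λ z → z ≢ x → Adj G x z) (λ z → ¬? (z Fin.≟ x) →-dec adj? x z) ¬univ
  ... | z , ¬adj-if-≢ =
    z , (λ z≡x → ¬adj-if-≢ λ z≢x → ⊥-elim (z≢x z≡x)) , λ adj-xz → ¬adj-if-≢ λ _ → adj-xz

  neighbours-isVisibilitySet : ∀ {x S} → Unique S → All (Adj G x) S → IsVisibilitySet G x S
  neighbours-isVisibilitySet {x} {S} uS adjs = uS , x∉S , λ y y∈S →
    step (All.lookup adjs y∈S) stop , shortest y∈S , λ { v (here refl) v∈S → ⊥-elim (x∉S v∈S)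
                                                     ; v (there (here refl)) _ → refl }
    where
    x∉S : x ∉ S
    x∉S x∈S = ¬Adj-refl (All.lookup adjs x∈S)
    shortest : ∀ {y} → y ∈ S → (q : Walk G x y) → 1 ≤ walkLength q
    shortest x∈S stop       = ⊥-elim (x∉S x∈S)
    shortest _   (step _ _) = s≤s z≤n

  closed-isVisibilitySet⇒neighbours : ∀ {x S} → IsVisibilitySet G x S →
    (∀ v → Adj G x v → v ∈ S) → All (Adj G x) S
  closed-isVisibilitySet⇒neighbours {x} {S} (_ , x∉S , visible) N[x]⊆S = All.tabulate adjacent
    where
    adjacent : ∀ {y} → y ∈ S → Adj G x y
    adjacent {y} y∈S with visible y y∈S
    ... | stop , _ , _ = ⊥-elim (x∉S y∈S)
    ... | step {y = w} adj-xw p , _ , only-y =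
          subst (Adj G x) (only-y w (there (head∈walkVertices p)) (N[x]⊆S w adj-xw)) adj-xw

  isVisibilitySet⇒outside-neighbour : ∀ {x S y} → IsVisibilitySet G x S → y ∈ S → ¬ Adj G x y →
    ∃[ u ] u ∉ x ∷ S × Adj G u y
  isVisibilitySet⇒outside-neighbour {x} {S} {y} (_ , x∉S , visible) y∈S ¬adj-xy with visible y y∈S
  ... | stop , _ , _ = ⊥-elim (x∉S y∈S)
  ... | step adj-xw p , _ , only-y with penultimate adj-xw p
  ... | u , u∈P , adj-uy = u , u∉x∷S , adj-uy
    where
    u∉x∷S : u ∉ x ∷ S
    u∉x∷S (here refl) = ¬adj-xy adj-uy
    u∉x∷S (there u∈S) = ¬Adj-refl (subst (λ v → Adj G v y) (only-y u u∈P u∈S) adj-uy)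

  visibility-bound-open : ∀ {x z S} → IsVisibilitySet G x S → Adj G x z → z ∉ S →
                          length S ≤ vvBound G
  visibility-bound-open {x} {z} {S} vis@(uS , x∉S , _) adj-xz z∉S =
    ≤[n*d∸1]/[1+d] (length S) (maxDeg G) n (open-case-arith
      (length≤length-filter+length-filter-∁ (adj? x) S)
      (length≤maxDeg (z∉S₁ ∷ Unique.filter⁺ (adj? x) uS) (adj-xz ∷ All.all-filter (adj? x) S))
      (length≤length*maxDeg (complement (x ∷ S)) (Unique.filter⁺ (∁? (adj? x)) uS) dominated)
      (length+length-complement≤order (¬Any⇒All¬ S x∉S ∷ uS)))
    where
    z∉S₁ : All (z ≢_) (filter (adj? x) S)
    z∉S₁ = ¬Any⇒All¬ _ λ z∈S₁ → z∉S (proj₁ (∈-filter⁻ (adj? x) {xs = S} z∈S₁))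
    dominated : ∀ {y} → y ∈ filter (∁? (adj? x)) S → ∃[ u ] u ∈ complement (x ∷ S) × Adj G u y
    dominated y∈S₂ with ∈-filter⁻ (∁? (adj? x)) {xs = S} y∈S₂
    ... | y∈S , ¬adj-xy with isVisibilitySet⇒outside-neighbour vis y∈S ¬adj-xy
    ... | u , u∉x∷S , adj-uy = u , ∉⇒∈-complement u∉x∷S , adj-uy

  visibility-bound-closed : ∀ {x S} → ¬ Universal G x → IsVisibilitySet G x S →
                            (∀ v → Adj G x v → v ∈ S) → length S ≤ vvBound G
  visibility-bound-closed {S = []}    _ _ _ = z≤n
  visibility-bound-closed {x} {S@(_ ∷ _)} ¬univ vis@(uS , x∉S , _) N[x]⊆S
    with ¬Universal⇒non-neighbour ¬univ
  ... | z , z≢x , ¬adj-xz =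
    ≤[n*d∸1]/[1+d] (length S) (maxDeg G) n (closed-case-arith (s≤s z≤n)
      (length≤maxDeg uS adjs)
      (length≤order ((z≢x ∘ sym ∷ ¬Any⇒All¬ S x∉S) ∷ z∉S ∷ uS)))
    where
    adjs : All (Adj G x) S
    adjs = closed-isVisibilitySet⇒neighbours vis N[x]⊆S
    z∉S : All (z ≢_) S
    z∉S = ¬Any⇒All¬ S λ z∈S → ¬adj-xz (All.lookup adjs z∈S)

  visibility-bound : ∀ {x S} → ¬ Universal G x → IsVisibilitySet G x S → length S ≤ vvBound G
  visibility-bound {x} {S} ¬univ vis with Fin.any? (λ z → adj? x z ×-dec ¬? (z ∈? S))
  ... | yes (z , adj-xz , z∉S) = visibility-bound-open vis adj-xz z∉S
  ... | no  ∄outside = visibility-bound-closed ¬univ vis λ v adj-xv →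
          decidable-stable (v ∈? S) λ v∉S → ∄outside (v , adj-xv , v∉S)

[2+m]/2≡1+m/2 : ∀ m → (2 + m) / 2 ≡ suc (m / 2)
[2+m]/2≡1+m/2 m = m/n≡1+[m∸n]/n {2 + m} {2} (s≤s (s≤s z≤n))

module _ (k : ℕ) where

  same-part⇒¬Adj : ∀ (u v : Fin (k * 2)) → toℕ u / 2 ≡ toℕ v / 2 → ¬ Adj (cocktail k) u v
  same-part⇒¬Adj u v same with toℕ u / 2 ≟ toℕ v / 2
  ... | yes _        = λ ()
  ... | no different = ⊥-elim (different same)

  different-parts⇒Adj : ∀ (u v : Fin (k * 2)) → toℕ u / 2 ≢ toℕ v / 2 → Adj (cocktail k) u v
  different-parts⇒Adj u v different with toℕ u / 2 ≟ toℕ v / 2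
  ... | yes same = ⊥-elim (different same)
  ... | no _     = tt

partner : ∀ k → Fin (k * 2) → Fin (k * 2)
partner (suc k) fzero           = fsuc fzero
partner (suc k) (fsuc fzero)    = fzero
partner (suc k) (fsuc (fsuc v)) = fsuc (fsuc (partner k v))

partner-same-part : ∀ k (v : Fin (k * 2)) → toℕ (partner k v) / 2 ≡ toℕ v / 2
partner-same-part (suc k) fzero           = refl
partner-same-part (suc k) (fsuc fzero)    = refl
partner-same-part (suc k) (fsuc (fsuc v)) = begin
  (2 + toℕ (partner k v)) / 2 ≡⟨ [2+m]/2≡1+m/2 (toℕ (partner k v)) ⟩
  suc (toℕ (partner k v) / 2) ≡⟨ cong suc (partner-same-part k v) ⟩
  suc (toℕ v / 2)             ≡⟨ [2+m]/2≡1+m/2 (toℕ v) ⟨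
  (2 + toℕ v) / 2             ∎
  where open ≡-Reasoning

partner≢ : ∀ k (v : Fin (k * 2)) → partner k v ≢ v
partner≢ (suc k) fzero           ()
partner≢ (suc k) (fsuc fzero)    ()
partner≢ (suc k) (fsuc (fsuc v)) eq = partner≢ k v (Fin.suc-injective (Fin.suc-injective eq))

cocktail-¬Universal : ∀ k x → ¬ Universal (cocktail k) x
cocktail-¬Universal k x univ =
  same-part⇒¬Adj k x (partner k x) (sym (partner-same-part k x)) (univ (partner k x) (partner≢ k x))

cocktail-vv-attained : ∀ {k} → k ≥ 1 → Σ (Fin (k * 2)) λ x → Σ (List (Fin (k * 2))) λ S →
                       IsVisibilitySet (cocktail k) x S × length S ≡ vvBound (cocktail k)
cocktail-vv-attained {suc m} _ = fzero , S , vis ,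
  ≤-antisym (visibility-bound G (cocktail-¬Universal (suc m) fzero) vis)
            (subst (vvBound G ≤_) (sym length-S) (vvBound≤order∸2 G))
  where
  G : Graph (suc m * 2)
  G = cocktail (suc m)
  S : List (Fin (suc m * 2))
  S = map (fsuc ∘ fsuc) (allFin (m * 2))
  length-S : length S ≡ m * 2
  length-S = trans (length-map (fsuc ∘ fsuc) (allFin (m * 2))) (length-allFin (m * 2))
  vis : IsVisibilitySet G fzero S
  vis = neighbours-isVisibilitySet G
    (Unique.map⁺ (Fin.suc-injective ∘ Fin.suc-injective) (Unique.allFin⁺ (m * 2)))
    (All.map⁺ (All.tabulate λ {i} _ → different-parts⇒Adj (suc m) fzero (fsuc (fsuc i)) λ 0≡ →
      0≢1+n (trans 0≡ ([2+m]/2≡1+m/2 (toℕ i)))))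

theorem3p4 : ((n : ℕ) (G : Graph n) → (∀ x → ¬ Universal G x) →
                ∀ x (S : List (Fin n)) → IsVisibilitySet G x S → length S ≤ vvBound G)
             × ((k : ℕ) → k ≥ 2 →
                Σ (Fin (k Data.Nat.* 2)) λ x → Σ (List (Fin (k Data.Nat.* 2))) λ S →
                  IsVisibilitySet (cocktail k) x S × length S ≡ vvBound (cocktail k))
theorem3p4 =
  (λ n G no-universal x S → visibility-bound G (no-universal x)) ,
  (λ k k≥2 → cocktail-vv-attained (≤-trans (s≤s z≤n) k≥2))
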